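{- The relations $\overset{\mathrm{irr}}{\sim}$ and $\overset{\mathrm{bal}}{\sim}$ on $\mathcal{M}$ coincide: if $v$ can be obtained from $w$ by a sequence of balanced commutations, then $v$ can also be obtained from $w$ by a sequence of irreducible balanced commutations.
   Context: $\mathcal{M}$ is the free monoid on letters $D,U$. A word is balanced if it has equally many $D$'s and $U$'s. A balanced word is irreducible if it is nonempty and is not a concatenation of two nonempty balanced words. A balanced commutation turns $pyxq$ into $pxyq$ for words $p,q$ and balanced words $x,y$; an irreducible balanced commutation is one where additionally $x,y$ are irreducible balanced words with different first letters. $\overset{\mathrm{bal}}{\sim}$ (resp. $\overset{\mathrm{irr}}{\sim}$) is the equivalence relation "obtainable by a finite sequence of balanced (resp. irreducible balanced) commutations". -}

module Defs where

open import Data.Nat using (ℕ; zero; suc)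
open import Data.List using (List; []; _∷_; _++_)
open import Data.Product using (Σ; _×_; _,_; ∃-syntax)
open import Relation.Binary.PropositionalEquality using (_≡_; _≢_)
open import Relation.Nullary using (¬_)
open import Relation.Binary.Construct.Closure.Equivalence using (EqClosure)

data Letter : Set where
  D U : Letter

-- Elements of 𝓜 are finite words (lists of letters); concatenation is _++_.
Word : Set
Word = List Letter

countD : Word → ℕ
countD []       = zero
countD (D ∷ w)  = suc (countD w)
countD (U ∷ w)  = countD w

countU : Word → ℕ
countU []       = zero
countU (D ∷ w)  = countU w
countU (U ∷ w)  = suc (countU w)

Balanced : Word → Set
Balanced w = countD w ≡ countU w

Irreducible : Word → Set
Irreducible w =
  (w ≢ []) × Balanced w ×
  (∀ (a b : Word) → a ≢ [] → b ≢ [] → Balanced a → Balanced b → w ≢ a ++ b)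

StartsWith : Letter → Word → Set
StartsWith l w = Σ Word λ t → w ≡ l ∷ t

data BalComm : Word → Word → Set where
  bal : (p q x y : Word) → Balanced x → Balanced y →
        BalComm (p ++ y ++ x ++ q) (p ++ x ++ y ++ q)

data IrrComm : Word → Word → Set where
  irr : (p q x y : Word) → Irreducible x → Irreducible y →
        (∀ (l m : Letter) → StartsWith l x → StartsWith m y → l ≢ m) →
        IrrComm (p ++ y ++ x ++ q) (p ++ x ++ y ++ q)

_∼bal_ : Word → Word → Set
_∼bal_ = EqClosure BalComm

_∼irr_ : Word → Word → Set
_∼irr_ = EqClosure IrrComm

-- It suffices that x ++ y ∼irr y ++ x for all balanced x and y, proved by
-- induction on |x| + |y|.  A factor that splits into two shorter nonempty
-- balanced words is moved across the other one piece by piece, and irreducible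
-- words with different first letters commute in one step.  An irreducible word
-- starting with c is c a c̄ with a balanced (the difference of its letter counts
-- first returns to zero at its last letter), and two such words l a r and l e r,
-- with l = c and r = c̄, are exchanged by
--   l a r l e r ∼ l (r l) a e r ∼ l (r l) e a r ∼ l e (r l) a r,
-- each step commuting two shorter balanced words.
module Submission where

open import Defs
open import Data.Empty using (⊥-elim)
open import Data.List using (List; []; _∷_; _++_; length)
open import Data.List.Properties
  using (++-assoc; ++-identityʳ; ++-monoid; length-++-≤ˡ; length-++-≤ʳ; length-++-sucʳ)
open import Data.Nat using (ℕ; zero; suc; _+_; _≤_; _<_; s≤s)
open import Data.Nat.Induction using (<-wellFounded)
open import Data.Nat.Properties
  using (+-suc; +-cancelˡ-≡; ≤-reflexive; +-monoˡ-<; +-monoʳ-<; +-mono-<; +-mono-<-≤; +-mono-≤-<)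
import Data.Nat.Properties as ℕ
open import Data.Product using (_×_; _,_; ∃; ∃₂)
open import Data.Sum using (_⊎_; inj₁; inj₂)
open import Function using (_∘_)
open import Induction.WellFounded using (Acc; acc)
open import Relation.Binary.Definitions using (DecidableEquality)
open import Relation.Binary.PropositionalEquality
open import Relation.Nullary using (Dec; yes; no; ¬_)
open import Relation.Nullary.Decidable using (map′; _×-dec_; _⊎-dec_)
import Relation.Binary.Construct.Closure.Equivalence as EqClosure
import Relation.Binary.Reasoning.Setoid as SetoidReasoning
open import Tactic.MonoidSolver using (solve)

Split : ∀ {A : Set} → (List A → List A → Set) → List A → Set
Split P w = ∃₂ λ a b → w ≡ a ++ b × P a b

split? : ∀ {A : Set} {P : List A → List A → Set} →
         (∀ a b → Dec (P a b)) → ∀ w → Dec (Split P w)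
split? P? [] = map′ (λ p → [] , [] , refl , p) (λ { ([] , [] , refl , p) → p }) (P? [] [])
split? {P = P} P? (c ∷ w) =
  map′ to from (P? [] (c ∷ w) ⊎-dec split? (λ a → P? (c ∷ a)) w)
  where
  to : P [] (c ∷ w) ⊎ Split (λ a → P (c ∷ a)) w → Split P (c ∷ w)
  to (inj₁ p) = [] , c ∷ w , refl , p
  to (inj₂ (a , b , refl , p)) = c ∷ a , b , refl , p
  from : Split P (c ∷ w) → P [] (c ∷ w) ⊎ Split (λ a → P (c ∷ a)) w
  from ([] , b , refl , p) = inj₁ p
  from (_ ∷ a , b , refl , p) = inj₂ (a , b , refl , p)

length-++-<ˡ : ∀ {A : Set} (a : List A) {b} → b ≢ [] → length a < length (a ++ b)
length-++-<ˡ a {b = []}    b≢[] = ⊥-elim (b≢[] refl)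
length-++-<ˡ a {b = c ∷ b} _ =
  subst (length a <_) (sym (length-++-sucʳ a c b)) (s≤s (length-++-≤ˡ a))

length-++-<ʳ : ∀ {A : Set} {a : List A} b → a ≢ [] → length b < length (a ++ b)
length-++-<ʳ {a = []}    b a≢[] = ⊥-elim (a≢[] refl)
length-++-<ʳ {a = _ ∷ a} b _    = s≤s (length-++-≤ʳ b {a})

flip : Letter → Letter
flip D = U
flip U = D

_≟_ : DecidableEquality Letter
D ≟ D = yes refl
U ≟ U = yes refl
D ≟ U = no λ ()
U ≟ D = no λ ()

count : Letter → Word → ℕ
count D = countD
count U = countU

countD-++ : ∀ a b → countD (a ++ b) ≡ countD a + countD b
countD-++ []      b = refl
countD-++ (D ∷ a) b = cong suc (countD-++ a b)
countD-++ (U ∷ a) b = countD-++ a b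

countU-++ : ∀ a b → countU (a ++ b) ≡ countU a + countU b
countU-++ []      b = refl
countU-++ (D ∷ a) b = countU-++ a b
countU-++ (U ∷ a) b = cong suc (countU-++ a b)

balanced? : ∀ w → Dec (Balanced w)
balanced? w = countD w ℕ.≟ countU w

balanced-++⁻ʳ : ∀ a b → Balanced (a ++ b) → Balanced a → Balanced b
balanced-++⁻ʳ a b bab ba = +-cancelˡ-≡ (countD a) _ _ (begin
  countD a + countD b  ≡⟨ countD-++ a b ⟨
  countD (a ++ b)      ≡⟨ bab ⟩
  countU (a ++ b)      ≡⟨ countU-++ a b ⟩
  countU a + countU b  ≡⟨ cong (_+ countU b) ba ⟨
  countD a + countU b  ∎)
  where open ≡-Reasoning

balanced-wrap : ∀ c a → Balanced a → Balanced (c ∷ a ++ flip c ∷ [])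
balanced-wrap D a ba = begin
  suc (countD (a ++ U ∷ []))  ≡⟨ cong suc (countD-++ a _) ⟩
  suc (countD a + 0)          ≡⟨ cong (λ n → suc (n + 0)) ba ⟩
  suc (countU a + 0)          ≡⟨ +-suc (countU a) 0 ⟨
  countU a + 1                ≡⟨ countU-++ a _ ⟨
  countU (a ++ U ∷ [])        ∎
  where open ≡-Reasoning
balanced-wrap U a ba = begin
  countD (a ++ D ∷ [])        ≡⟨ countD-++ a _ ⟩
  countD a + 1                ≡⟨ +-suc (countD a) 0 ⟩
  suc (countD a + 0)          ≡⟨ cong (λ n → suc (n + 0)) ba ⟩
  suc (countU a + 0)          ≡⟨ cong suc (countU-++ a _) ⟨
  suc (countU (a ++ D ∷ []))  ∎
  where open ≡-Reasoning

first-passage : ∀ c k z → k + count c z < count (flip c) z →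
                ∃₂ λ z₁ z₂ → z ≡ z₁ ++ flip c ∷ z₂ × count (flip c) z₁ ≡ k + count c z₁
first-passage D k       []      ()
first-passage U k       []      ()
first-passage D zero    (U ∷ z) _ = [] , z , refl , refl
first-passage U zero    (D ∷ z) _ = [] , z , refl , refl
first-passage D (suc k) (U ∷ z) (s≤s h) with first-passage D k z h
... | z₁ , z₂ , refl , e = U ∷ z₁ , z₂ , refl , cong suc e
first-passage U (suc k) (D ∷ z) (s≤s h) with first-passage U k z h
... | z₁ , z₂ , refl , e = D ∷ z₁ , z₂ , refl , cong suc e
first-passage D k (D ∷ z) h with first-passage D (suc k) z (subst (_< countU z) (+-suc k _) h)
... | z₁ , z₂ , refl , e = D ∷ z₁ , z₂ , refl , trans e (sym (+-suc k _))
first-passage U k (U ∷ z) h with first-passage U (suc k) z (subst (_< countD z) (+-suc k _) h)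
... | z₁ , z₂ , refl , e = U ∷ z₁ , z₂ , refl , trans e (sym (+-suc k _))

balanced-∷⇒< : ∀ c x → Balanced (c ∷ x) → count c x < count (flip c) x
balanced-∷⇒< D x b = ≤-reflexive b
balanced-∷⇒< U x b = ≤-reflexive (sym b)

count-flip⇒balanced : ∀ c a → count (flip c) a ≡ count c a → Balanced a
count-flip⇒balanced D a e = sym e
count-flip⇒balanced U a e = e

irreducible⇒wrapped : ∀ c x → Irreducible (c ∷ x) →
                      ∃ λ a → Balanced a × x ≡ a ++ flip c ∷ []
irreducible⇒wrapped c x (_ , bx , noSplit) with first-passage c 0 x (balanced-∷⇒< c x bx)
... | a , []    , refl , e = a , count-flip⇒balanced c a e , refl
... | a , b@(_ ∷ _) , refl , e =
  ⊥-elim (noSplit w b (λ ()) (λ ()) bw bb split)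
  where
  w : Word
  w = c ∷ a ++ flip c ∷ []
  bw : Balanced w
  bw = balanced-wrap c a (count-flip⇒balanced c a e)
  split : c ∷ a ++ flip c ∷ b ≡ w ++ b
  split = cong (c ∷_) (sym (++-assoc a (flip c ∷ []) b))
  bb : Balanced b
  bb = balanced-++⁻ʳ w b (subst Balanced split bx) bw

Reducible : Word → Set
Reducible = Split λ a b → a ≢ [] × b ≢ [] × Balanced a × Balanced b

nonEmpty? : ∀ (a : Word) → Dec (a ≢ [])
nonEmpty? []      = no λ a≢[] → a≢[] refl
nonEmpty? (_ ∷ _) = yes λ ()

reducible? : ∀ w → Dec (Reducible w)
reducible? = split? λ a b → nonEmpty? a ×-dec nonEmpty? b ×-dec balanced? a ×-dec balanced? b

¬reducible⇒irreducible : ∀ {w} → w ≢ [] → Balanced w → ¬ Reducible w → Irreducible w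
¬reducible⇒irreducible w≢[] bw ¬r =
  w≢[] , bw , λ a b a≢[] b≢[] ba bb w≡ab → ¬r (a , b , w≡ab , a≢[] , b≢[] , ba , bb)

IrrComm-cong : ∀ p q {s t} → IrrComm s t → IrrComm (p ++ s ++ q) (p ++ t ++ q)
IrrComm-cong p q (irr p₀ q₀ x y ix iy distinct) =
  subst₂ IrrComm (reassoc y x) (reassoc x y) (irr (p ++ p₀) (q₀ ++ q) x y ix iy distinct)
  where
  reassoc : ∀ u v → (p ++ p₀) ++ u ++ v ++ q₀ ++ q ≡ p ++ (p₀ ++ u ++ v ++ q₀) ++ q
  reassoc u v = solve (++-monoid Letter)

∼irr-cong : ∀ p q {s t} → s ∼irr t → (p ++ s ++ q) ∼irr (p ++ t ++ q)
∼irr-cong p q = EqClosure.gmap (λ s → p ++ s ++ q) (IrrComm-cong p q)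

≡⇒∼irr : ∀ {s t} → s ≡ t → s ∼irr t
≡⇒∼irr refl = EqClosure.reflexive IrrComm

Commute : Word → Word → Set
Commute x y = (x ++ y) ∼irr (y ++ x)

module ∼irr-Reasoning = SetoidReasoning (EqClosure.setoid IrrComm)

commute-++ˡ : ∀ {a b y} → Commute a y → Commute b y → Commute (a ++ b) y
commute-++ˡ {a} {b} {y} ay by = begin
  (a ++ b) ++ y         ≡⟨ solve (++-monoid Letter) ⟩
  a ++ (b ++ y) ++ []   ≈⟨ ∼irr-cong a [] by ⟩
  a ++ (y ++ b) ++ []   ≡⟨ solve (++-monoid Letter) ⟩
  [] ++ (a ++ y) ++ b   ≈⟨ ∼irr-cong [] b ay ⟩
  [] ++ (y ++ a) ++ b   ≡⟨ solve (++-monoid Letter) ⟩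
  y ++ a ++ b           ∎
  where open ∼irr-Reasoning

commute-wrapped : ∀ {l r a e} → Commute a (r ++ l) → Commute a e → Commute (r ++ l) e →
                  Commute (l ++ a ++ r) (l ++ e ++ r)
commute-wrapped {l} {r} {a} {e} a-rl ae rl-e = begin
  (l ++ a ++ r) ++ l ++ e ++ r      ≡⟨ solve (++-monoid Letter) ⟩
  l ++ (a ++ r ++ l) ++ e ++ r      ≈⟨ ∼irr-cong l (e ++ r) a-rl ⟩
  l ++ ((r ++ l) ++ a) ++ e ++ r    ≡⟨ solve (++-monoid Letter) ⟩
  (l ++ r ++ l) ++ (a ++ e) ++ r    ≈⟨ ∼irr-cong (l ++ r ++ l) r ae ⟩
  (l ++ r ++ l) ++ (e ++ a) ++ r    ≡⟨ solve (++-monoid Letter) ⟩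
  l ++ ((r ++ l) ++ e) ++ a ++ r    ≈⟨ ∼irr-cong l (a ++ r) rl-e ⟩
  l ++ (e ++ r ++ l) ++ a ++ r      ≡⟨ solve (++-monoid Letter) ⟩
  (l ++ e ++ r) ++ l ++ a ++ r      ∎
  where open ∼irr-Reasoning

commute-sym : ∀ {x y} → Commute x y → Commute y x
commute-sym = EqClosure.symmetric IrrComm

commute-++ʳ : ∀ {x a b} → Commute x a → Commute x b → Commute x (a ++ b)
commute-++ʳ {x} {a} {b} xa xb =
  commute-sym {a ++ b} (commute-++ˡ {a} {b} {x} (commute-sym {x} xa) (commute-sym {x} xb))

commute-distinct : ∀ {c d x y} → c ≢ d → Irreducible (c ∷ x) → Irreducible (d ∷ y) →
                   Commute (c ∷ x) (d ∷ y)
commute-distinct {c} {d} {x} {y} c≢d ix iy =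
  EqClosure.return (subst₂ IrrComm (cong ((c ∷ x) ++_) (++-identityʳ (d ∷ y)))
                                   (cong ((d ∷ y) ++_) (++-identityʳ (c ∷ x)))
                                   (irr [] [] (d ∷ y) (c ∷ x) iy ix distinct))
  where
  distinct : ∀ l m → StartsWith l (d ∷ y) → StartsWith m (c ∷ x) → l ≢ m
  distinct _ _ (_ , refl) (_ , refl) = c≢d ∘ sym

CommuteBelow : ℕ → Set
CommuteBelow n = ∀ u v → Balanced u → Balanced v → length u + length v < n → Commute u v

commute-reducibleˡ : ∀ {x y} → Reducible x → Balanced y →
                     CommuteBelow (length x + length y) → Commute x y
commute-reducibleˡ {y = y} (a , b , refl , a≢[] , b≢[] , ba , bb) by ih =
  commute-++ˡ {a} {b} {y} (ih a y ba by (+-monoˡ-< (length y) (length-++-<ˡ a b≢[])))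
                          (ih b y bb by (+-monoˡ-< (length y) (length-++-<ʳ b a≢[])))

commute-reducibleʳ : ∀ {x y} → Reducible y → Balanced x →
                     CommuteBelow (length x + length y) → Commute x y
commute-reducibleʳ {x = x} (a , b , refl , a≢[] , b≢[] , ba , bb) bx ih =
  commute-++ʳ {x} {a} {b} (ih x a bx ba (+-monoʳ-< (length x) (length-++-<ˡ a b≢[])))
                          (ih x b bx bb (+-monoʳ-< (length x) (length-++-<ʳ b a≢[])))

balanced-flip-pair : ∀ c → Balanced (flip c ∷ c ∷ [])
balanced-flip-pair D = refl
balanced-flip-pair U = refl

commute-irreducible : ∀ {c d x y} → Irreducible (c ∷ x) → Irreducible (d ∷ y) →
                      CommuteBelow (length (c ∷ x) + length (d ∷ y)) →
                      Commute (c ∷ x) (d ∷ y)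
commute-irreducible {c} {d} {x} {y} ix iy ih with c ≟ d
... | no c≢d = commute-distinct c≢d ix iy
... | yes refl with irreducible⇒wrapped c x ix | irreducible⇒wrapped c y iy
...   | a , ba , refl | e , be , refl =
  commute-wrapped {c ∷ []} {flip c ∷ []} {a} {e}
    (ih a (flip c ∷ c ∷ []) ba (balanced-flip-pair c) (+-mono-<-≤ (inner a) (outer e)))
    (ih a e ba be (+-mono-< (inner a) (inner e)))
    (ih (flip c ∷ c ∷ []) e (balanced-flip-pair c) be (+-mono-≤-< (outer a) (inner e)))
  where
  inner : ∀ u → length u < length (c ∷ u ++ flip c ∷ [])
  inner u = s≤s (length-++-≤ˡ u)
  outer : ∀ u → 2 ≤ length (c ∷ u ++ flip c ∷ [])
  outer u = s≤s (length-++-≤ʳ (flip c ∷ []) {u})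

commute-step : ∀ x y → Balanced x → Balanced y →
               CommuteBelow (length x + length y) → Commute x y
commute-step []      y       _  _  _  = ≡⇒∼irr (sym (++-identityʳ y))
commute-step (c ∷ x) []      _  _  _  = ≡⇒∼irr (++-identityʳ (c ∷ x))
commute-step (c ∷ x) (d ∷ y) bx by ih with reducible? (c ∷ x) | reducible? (d ∷ y)
... | yes rx  | _       = commute-reducibleˡ rx by ih
... | no _    | yes ry  = commute-reducibleʳ ry bx ih
... | no ¬rx  | no ¬ry  =
  commute-irreducible (¬reducible⇒irreducible (λ ()) bx ¬rx)
                      (¬reducible⇒irreducible (λ ()) by ¬ry) ih

balanced-commute : ∀ x y → Balanced x → Balanced y → Commute x y
balanced-commute x y bx by = go x y bx by (<-wellFounded _)
  where
  go : ∀ x y → Balanced x → Balanced y → Acc _<_ (length x + length y) → Commute x y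
  go x y bx by (acc below) = commute-step x y bx by λ u v bu bv lt → go u v bu bv (below lt)

BalComm⇒∼irr : ∀ {s t} → BalComm s t → s ∼irr t
BalComm⇒∼irr (bal p q x y bx by) =
  subst₂ _∼irr_ (cong (p ++_) (++-assoc y x q)) (cong (p ++_) (++-assoc x y q))
    (∼irr-cong p q (balanced-commute y x by bx))

IrrComm⇒BalComm : ∀ {s t} → IrrComm s t → BalComm s t
IrrComm⇒BalComm (irr p q x y (_ , bx , _) (_ , by , _) _) = bal p q x y bx by

theorem9p1 : ∀ (w v : Word) → ((w ∼bal v → w ∼irr v) × (w ∼irr v → w ∼bal v))
theorem9p1 w v =
    EqClosure.fold (EqClosure.isEquivalence IrrComm) BalComm⇒∼irr
  , EqClosure.map IrrComm⇒BalComm
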